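{- Let $H=(X,\mathcal{B})$ be a segregated $k$-uniform hypergraph with $|X|=n$, $|\mathcal{B}|=j$ and exactly $r$ isolated blocks, and let $d_2$ be the number of vertices of degree $2$. Then \[d_2\ge 3n-2rk-jk.\]
   Context: $k$-uniform means all blocks have $k$ elements. The degree of a vertex is the number of blocks containing it. A block is isolated if it is disjoint from every other block; the hypergraph is segregated if no vertex has degree $0$ and every vertex of degree $1$ lies in an isolated block. -}

module Defs where

open import Data.Nat using (ℕ)
import Data.Nat as ℕ
open import Data.Fin using (Fin)
open import Data.Fin.Properties using (_≟_; all?)
open import Data.Fin.Subset using (Subset; _∈_; ∣_∣; Empty; _∩_)
open import Data.Fin.Subset.Properties using (_∈?_; nonempty?)
open import Data.List using (List; length; filter; allFin)
open import Relation.Nullary using (¬_; Dec; ¬?; _→-dec_)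
open import Relation.Binary.PropositionalEquality using (_≡_)
open import Data.Product using (_×_)
open import Function.Definitions using (Injective)

-- A hypergraph H = (X, 𝓑) with vertex set X = Fin n (so |X| = n) and
-- j blocks, given as an injective family block : Fin j → Subset n
-- (injective because 𝓑 is a set of blocks, so |𝓑| = j).
record Hypergraph (n j : ℕ) : Set where
  field
    block    : Fin j → Subset n
    distinct : Injective _≡_ _≡_ block
open Hypergraph public

degree : ∀ {n j} → Hypergraph n j → Fin n → ℕ
degree {j = j} H x = length (filter (λ b → x ∈? block H b) (allFin j))

Uniform : ∀ {n j} → ℕ → Hypergraph n j → Set
Uniform k H = ∀ b → ∣ block H b ∣ ≡ k

Isolated : ∀ {n j} → Hypergraph n j → Fin j → Set
Isolated H b = ∀ b' → ¬ (b' ≡ b) → Empty (block H b ∩ block H b')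

isolated? : ∀ {n j} (H : Hypergraph n j) (b : Fin j) → Dec (Isolated H b)
isolated? H b = all? λ b' → ¬? (b' ≟ b) →-dec ¬? (nonempty? (block H b ∩ block H b'))

Segregated : ∀ {n j} → Hypergraph n j → Set
Segregated H =
  (∀ x → ¬ (degree H x ≡ 0)) ×
  (∀ x → degree H x ≡ 1 → ∀ b → x ∈ block H b → Isolated H b)

isolatedCount : ∀ {n j} → Hypergraph n j → ℕ
isolatedCount {j = j} H = length (filter (isolated? H) (allFin j))

d₂ : ∀ {n j} → Hypergraph n j → ℕ
d₂ {n} H = length (filter (λ x → degree H x ℕ.≟ 2) (allFin n))

-- Give every vertex x the weight
--   deg x + [deg x = 2] + 2 · (number of isolated blocks containing x).
-- The weight is at least 3: degree 0 is excluded, degree 1 forces x into an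
-- isolated block, degree 2 earns the extra 1, and degree ≥ 3 suffices alone.
-- Summing over the vertices by double counting gives 3n ≤ jk + d₂ + 2rk.
module Submission where

open import Defs
open import Data.Nat using (ℕ; _+_; _*_; _≤_)
open import Relation.Binary.PropositionalEquality using (_≡_)

open import Data.Nat using (zero; suc; z≤n; s≤s)
import Data.Nat as ℕ
open import Data.Nat.Properties
  using (+-*-semiring; ≤-refl; ≤-reflexive; ≤-trans; +-mono-≤; *-monoʳ-≤; *-comm; module ≤-Reasoning)
open import Data.Nat.Solver using (module +-*-Solver)
open import Algebra.Properties.Semiring.Sum +-*-semiring
  using (sum; sum-syntax; sum-cong-≗; ∑-comm; ∑-distrib-+; *-distribˡ-sum; *-distribʳ-sum)
open import Data.Bool using (if_then_else_)
open import Data.Fin using (Fin)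
import Data.Fin as Fin
open import Data.Fin.Subset using (Subset; inside; outside; ∣_∣)
open import Data.Fin.Subset.Properties using (_∈?_)
open import Data.Vec using ([]; _∷_)
open import Data.List using (length; filter; tabulate)
open import Relation.Nullary using (Dec; yes; no; does)
open import Relation.Unary using (Pred; Decidable)
open import Relation.Binary.PropositionalEquality using (refl; sym; trans; cong; cong₂; module ≡-Reasoning)
open import Data.Product using (_,_)
open import Data.Empty using (⊥-elim)
open import Function using (_∘_)

𝟙 : ∀ {a} {A : Set a} → Dec A → ℕ
𝟙 d = if does d then 1 else 0

𝟙-yes : ∀ {a} {A : Set a} (d : Dec A) → A → 𝟙 d ≡ 1
𝟙-yes (yes _) _ = refl
𝟙-yes (no ¬a) a = ⊥-elim (¬a a)

sum-mono-≤ : ∀ {n} {f g : Fin n → ℕ} → (∀ i → f i ≤ g i) → sum f ≤ sum g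
sum-mono-≤ {zero}  f≤g = z≤n
sum-mono-≤ {suc n} f≤g = +-mono-≤ (f≤g Fin.zero) (sum-mono-≤ (f≤g ∘ Fin.suc))

∑-const : ∀ n c → ∑[ i < n ] c ≡ n * c
∑-const zero    c = refl
∑-const (suc n) c = cong (c +_) (∑-const n c)

length-filter-tabulate : ∀ {a p} {A : Set a} {P : Pred A p} (P? : Decidable P) {n} (f : Fin n → A) →
  length (filter P? (tabulate f)) ≡ ∑[ i < n ] 𝟙 (P? (f i))
length-filter-tabulate P? {zero}  f = refl
length-filter-tabulate P? {suc n} f with P? (f Fin.zero)
... | yes _ = cong suc (length-filter-tabulate P? (f ∘ Fin.suc))
... | no  _ = length-filter-tabulate P? (f ∘ Fin.suc)

∣p∣≡∑∈ : ∀ {n} (p : Subset n) → ∣ p ∣ ≡ ∑[ x < n ] 𝟙 (x ∈? p)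
∣p∣≡∑∈ []            = refl
∣p∣≡∑∈ (inside  ∷ p) = cong suc (∣p∣≡∑∈ p)
∣p∣≡∑∈ (outside ∷ p) = ∣p∣≡∑∈ p

module _ {n j} (H : Hypergraph n j) where

  isolatedDegree : Fin n → ℕ
  isolatedDegree x = ∑[ b < j ] (𝟙 (isolated? H b) * 𝟙 (x ∈? block H b))

  degree≡∑ : ∀ x → degree H x ≡ ∑[ b < j ] 𝟙 (x ∈? block H b)
  degree≡∑ x = length-filter-tabulate (λ b → x ∈? block H b) (λ b → b)

  isolatedCount≡∑ : isolatedCount H ≡ ∑[ b < j ] 𝟙 (isolated? H b)
  isolatedCount≡∑ = length-filter-tabulate (isolated? H) (λ b → b)

  d₂≡∑ : d₂ H ≡ ∑[ x < n ] 𝟙 (degree H x ℕ.≟ 2)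
  d₂≡∑ = length-filter-tabulate (λ x → degree H x ℕ.≟ 2) (λ x → x)

  ∑-incidence : ∀ {k} → Uniform k H → ∀ b → ∑[ x < n ] 𝟙 (x ∈? block H b) ≡ k
  ∑-incidence uniform b = trans (sym (∣p∣≡∑∈ (block H b))) (uniform b)

  ∑-degree : ∀ {k} → Uniform k H → ∑[ x < n ] degree H x ≡ j * k
  ∑-degree {k} uniform = begin
    ∑[ x < n ] degree H x                     ≡⟨ sum-cong-≗ degree≡∑ ⟩
    ∑[ x < n ] ∑[ b < j ] 𝟙 (x ∈? block H b)  ≡⟨ ∑-comm (λ x b → 𝟙 (x ∈? block H b)) ⟩
    ∑[ b < j ] ∑[ x < n ] 𝟙 (x ∈? block H b)  ≡⟨ sum-cong-≗ (∑-incidence uniform) ⟩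
    ∑[ b < j ] k                              ≡⟨ ∑-const j k ⟩
    j * k                                     ∎
    where open ≡-Reasoning

  ∑-isolatedDegree : ∀ {k} → Uniform k H → ∑[ x < n ] isolatedDegree x ≡ isolatedCount H * k
  ∑-isolatedDegree {k} uniform = begin
    ∑[ x < n ] ∑[ b < j ] (isolated b * 𝟙 (x ∈? block H b))
      ≡⟨ ∑-comm (λ x b → isolated b * 𝟙 (x ∈? block H b)) ⟩
    ∑[ b < j ] ∑[ x < n ] (isolated b * 𝟙 (x ∈? block H b))
      ≡⟨ sum-cong-≗ (λ b → sym (*-distribˡ-sum (isolated b) (λ x → 𝟙 (x ∈? block H b)))) ⟩
    ∑[ b < j ] (isolated b * ∑[ x < n ] 𝟙 (x ∈? block H b))
      ≡⟨ sum-cong-≗ (λ b → cong (isolated b *_) (∑-incidence uniform b)) ⟩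
    ∑[ b < j ] (isolated b * k)
      ≡⟨ *-distribʳ-sum k isolated ⟨
    (∑[ b < j ] isolated b) * k
      ≡⟨ cong (_* k) isolatedCount≡∑ ⟨
    isolatedCount H * k
      ∎
    where
    open ≡-Reasoning
    isolated : Fin j → ℕ
    isolated b = 𝟙 (isolated? H b)

  degree≤isolatedDegree : Segregated H → ∀ x → degree H x ≡ 1 → degree H x ≤ isolatedDegree x
  degree≤isolatedDegree (_ , deg1⇒isolated) x deg1 =
    ≤-trans (≤-reflexive (degree≡∑ x)) (sum-mono-≤ incidence≤isolated)
    where
    incidence≤isolated : ∀ b → 𝟙 (x ∈? block H b) ≤ 𝟙 (isolated? H b) * 𝟙 (x ∈? block H b)
    incidence≤isolated b with x ∈? block H b
    ... | no  _   = z≤n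
    ... | yes x∈b = ≤-reflexive (cong (_* 1) (sym (𝟙-yes (isolated? H b) (deg1⇒isolated x deg1 b x∈b))))

  3≤weight : Segregated H → ∀ x → 3 ≤ degree H x + 𝟙 (degree H x ℕ.≟ 2) + 2 * isolatedDegree x
  3≤weight seg@(no-deg0 , _) x with degree H x in deg | degree≤isolatedDegree seg x
  ... | 0                 | _     = ⊥-elim (no-deg0 x deg)
  ... | 1                 | 1≤iso = +-mono-≤ {1} ≤-refl (*-monoʳ-≤ 2 (1≤iso refl))
  ... | 2                 | _     = s≤s (s≤s (s≤s z≤n))
  ... | suc (suc (suc _)) | _     = s≤s (s≤s (s≤s z≤n))

lemma3p12 : (n j k r : ℕ) (H : Hypergraph n j) →
    Uniform k H → Segregated H → isolatedCount H ≡ r →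
    3 * n ≤ d₂ H + 2 * r * k + j * k
lemma3p12 n j k r H uniform segregated refl = begin
  3 * n                                 ≡⟨ *-comm 3 n ⟩
  n * 3                                 ≡⟨ ∑-const n 3 ⟨
  ∑[ x < n ] 3                          ≤⟨ sum-mono-≤ (3≤weight H segregated) ⟩
  ∑[ x < n ] (deg x + 𝟙 (deg x ℕ.≟ 2) + 2 * iso x)
    ≡⟨ ∑-distrib-+ (λ x → deg x + 𝟙 (deg x ℕ.≟ 2)) (λ x → 2 * iso x) ⟩
  ∑[ x < n ] (deg x + 𝟙 (deg x ℕ.≟ 2)) + ∑[ x < n ] (2 * iso x)
    ≡⟨ cong₂ _+_ (∑-distrib-+ deg (λ x → 𝟙 (deg x ℕ.≟ 2))) (sym (*-distribˡ-sum 2 iso)) ⟩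
  ∑[ x < n ] deg x + ∑[ x < n ] 𝟙 (deg x ℕ.≟ 2) + 2 * ∑[ x < n ] iso x
    ≡⟨ cong₂ _+_ (cong₂ _+_ (∑-degree H uniform) (sym (d₂≡∑ H))) (cong (2 *_) (∑-isolatedDegree H uniform)) ⟩
  j * k + d₂ H + 2 * (r * k)
    ≡⟨ solve 4 (λ d₂ j k r → j :* k :+ d₂ :+ con 2 :* (r :* k) := d₂ :+ con 2 :* r :* k :+ j :* k)
               refl (d₂ H) j k r ⟩
  d₂ H + 2 * r * k + j * k              ∎
  where
  open ≤-Reasoning
  open +-*-Solver
  deg = degree H
  iso = isolatedDegree H
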